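{- Every finite non-empty type is continuously searchable.
   Context: $\mathfrak S$-types are defined inductively: every finite non-empty type is an $\mathfrak S$-type; if $S,S'$ are $\mathfrak S$-types then so is $S\times S'$; if $S$ is an $\mathfrak S$-type then so is $\mathbb N\to S$. The exactness type $E(S)$: $E(F)=\mathbf 1$ for finite $F$; $E(S\times S')=E(S)\times E(S')$; $E(\mathbb N\to S)=\mathbb N\times E(S)$. Equality with precision $p\in E(S)$, $x\equiv_p y$: for finite types iff $x=y$; for products componentwise; for sequences, $\alpha\equiv_{(m,p)}\beta$ iff $\alpha(i)\equiv_p\beta(i)$ for all $i<m$. A predicate $Q$ on $S$ is continuous if there is $q\in E(S)$ such that $x\equiv_q x'$ and $Q(x)$ imply $Q(x')$; it is detachable if it is decidable (for each $x$, either $Q(x)$ or $\neg Q(x)$). A searcher on $S$ is a function $\mathscr E$ assigning to each detachable continuous predicate $Q$ on $S$ an element $\mathscr E(Q)\in S$ such that if some $x\in S$ satisfies $Q$ then $Q(\mathscr E(Q))$ holds. For predicates $P,Q$ on $S$ and $p\in E(S)$, $P\Leftrightarrow_p Q$ means that for all $x,x'\in S$ with $x\equiv_p x'$, $P(x)$ holds iff $Q(x')$ holds. A searcher is continuous if for all detachable continuous $P,Q$ and all $p\in E(S)$, $P\Leftrightarrow_p Q$ implies $\mathscr E(P)\equiv_p\mathscr E(Q)$. An $\mathfrak S$-type is continuously searchable if it has a continuous searcher. -}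

module Defs where

open import Data.Nat using (ℕ; suc; _<_)
open import Data.Fin using (Fin; toℕ)
open import Data.Unit using (⊤)
open import Data.Product using (Σ; ∃; _×_; _,_; proj₁)
open import Relation.Nullary using (Dec)
open import Relation.Binary.PropositionalEquality using (_≡_)
open import Function.Bundles using (_↔_)

data SType : Set₁ where
  fin  : (A : Set) (n : ℕ) → A ↔ Fin (suc n) → SType
  _⊗_  : SType → SType → SType
  seq  : SType → SType

El : SType → Set
El (fin A n e) = A
El (S ⊗ S')    = El S × El S'
El (seq S)     = ℕ → El S

E : SType → Set
E (fin A n e) = ⊤
E (S ⊗ S')    = E S × E S'
E (seq S)     = ℕ × E S

Eq : (S : SType) → E S → El S → El S → Set
Eq (fin A n e) p x y               = x ≡ y
Eq (S ⊗ S') (p , p') (x , x') (y , y') = Eq S p x y × Eq S' p' x' y'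
Eq (seq S) (m , p) α β             = (i : ℕ) → i < m → Eq S p (α i) (β i)

Detachable : (S : SType) → (El S → Set) → Set
Detachable S Q = (x : El S) → Dec (Q x)

Continuous : (S : SType) → (El S → Set) → Set
Continuous S Q = Σ (E S) λ q → (x x' : El S) → Eq S q x x' → Q x → Q x'

record DCPred (S : SType) : Set₁ where
  field
    pred : El S → Set
    detachable : Detachable S pred
    continuous : Continuous S pred
open DCPred public

_⇔[_]_ : {S : SType} → DCPred S → E S → DCPred S → Set
_⇔[_]_ {S} P p Q = (x x' : El S) → Eq S p x x' →
  (pred P x → pred Q x') × (pred Q x' → pred P x)

Searcher : SType → Set₁
Searcher S = Σ (DCPred S → El S) λ 𝓔 →
  (Q : DCPred S) → (Σ (El S) λ x → pred Q x) → pred Q (𝓔 Q)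

IsContinuousSearcher : (S : SType) → Searcher S → Set₁
IsContinuousSearcher S (𝓔 , _) =
  (P Q : DCPred S) (p : E S) → P ⇔[ p ] Q → Eq S p (𝓔 P) (𝓔 Q)

ContinuouslySearchable : SType → Set₁
ContinuouslySearchable S = Σ (Searcher S) (IsContinuousSearcher S)

-- On a finite type the searcher picks the first element (in the order given
-- by the enumeration A ↔ Fin (suc n)) satisfying the predicate, defaulting to
-- the last one.  Which element gets picked depends only on the extension of
-- the predicate, and on a finite type every precision is exact equality, so
-- P ⇔[ p ] Q forces P and Q to pick the same element.
module Submission where

open import Defs
open import Level using (Level)
open import Data.Nat using (ℕ; zero; suc)
open import Data.Fin using (Fin; zero; suc)
open import Data.Product using (Σ; _,_; proj₁; proj₂)
open import Function using (_∘_)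
open import Function.Bundles using (_↔_; Inverse)
open import Relation.Nullary using (yes; no; contradiction)
open import Relation.Unary using (Pred; Decidable; _≐_)
open import Relation.Binary.PropositionalEquality using (_≡_; refl; cong; sym; subst)

private
  variable
    ℓ ℓ′ : Level
    n : ℕ

firstOrLast : {P : Pred (Fin (suc n)) ℓ} → Decidable P → Fin (suc n)
firstOrLast {n = zero}  P? = zero
firstOrLast {n = suc n} P? with P? zero
... | yes _ = zero
... | no  _ = suc (firstOrLast (P? ∘ suc))

firstOrLast-satisfies : {P : Pred (Fin (suc n)) ℓ} (P? : Decidable P) →
                        ∀ i → P i → P (firstOrLast P?)
firstOrLast-satisfies {n = zero}  P? zero    Pi = Pi
firstOrLast-satisfies {n = suc n} P? i       Pi with P? zero
... | yes P0 = P0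
firstOrLast-satisfies {n = suc n} P? zero    Pi | no ¬P0 = contradiction Pi ¬P0
firstOrLast-satisfies {n = suc n} P? (suc i) Pi | no _   =
  firstOrLast-satisfies (P? ∘ suc) i Pi

firstOrLast-cong : {P : Pred (Fin (suc n)) ℓ} {Q : Pred (Fin (suc n)) ℓ′}
                   (P? : Decidable P) (Q? : Decidable Q) →
                   P ≐ Q → firstOrLast P? ≡ firstOrLast Q?
firstOrLast-cong {n = zero}  P? Q? P≐Q = refl
firstOrLast-cong {n = suc n} P? Q? P≐Q with P? zero | Q? zero
... | yes _  | yes _  = refl
... | yes P0 | no ¬Q0 = contradiction (proj₁ P≐Q P0) ¬Q0
... | no ¬P0 | yes Q0 = contradiction (proj₂ P≐Q Q0) ¬P0
... | no _   | no _   =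
  cong suc (firstOrLast-cong (P? ∘ suc) (Q? ∘ suc) (proj₁ P≐Q , proj₂ P≐Q))

module _ {A : Set} (e : A ↔ Fin (suc n)) where
  open Inverse e

  searchFinite : {P : Pred A ℓ} → Decidable P → A
  searchFinite P? = from (firstOrLast (P? ∘ from))

  searchFinite-satisfies : {P : Pred A ℓ} (P? : Decidable P) →
                           ∀ x → P x → P (searchFinite P?)
  searchFinite-satisfies {P = P} P? x Px =
    firstOrLast-satisfies (P? ∘ from) (to x) (subst P (sym (strictlyInverseʳ x)) Px)

  searchFinite-cong : {P : Pred A ℓ} {Q : Pred A ℓ′}
                      (P? : Decidable P) (Q? : Decidable Q) →
                      P ≐ Q → searchFinite P? ≡ searchFinite Q?
  searchFinite-cong P? Q? (P⊆Q , Q⊆P) =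
    cong from (firstOrLast-cong (P? ∘ from) (Q? ∘ from) (P⊆Q , Q⊆P))

mainTheorem4 : (A : Set) (n : ℕ) (e : A ↔ Fin (suc n)) → ContinuouslySearchable (fin A n e)
mainTheorem4 A n e = (𝓔 , 𝓔-satisfies) , 𝓔-continuous
  where
    𝓔 : DCPred (fin A n e) → A
    𝓔 Q = searchFinite e (detachable Q)

    𝓔-satisfies : (Q : DCPred (fin A n e)) → Σ A (pred Q) → pred Q (𝓔 Q)
    𝓔-satisfies Q (x , Qx) = searchFinite-satisfies e (detachable Q) x Qx

    𝓔-continuous : IsContinuousSearcher (fin A n e) (𝓔 , 𝓔-satisfies)
    𝓔-continuous P Q _ P⇔Q = searchFinite-cong e (detachable P) (detachable Q)
      ((λ {x} → proj₁ (P⇔Q x x refl)) , (λ {x} → proj₂ (P⇔Q x x refl)))
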